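{- Let $c,N,M$ be positive integers with $N\le c$. If $\chi$ is a partial $c$-coloring of $G_{N,M}$, then $\chi$ can be extended to a (total) $c$-coloring of $G_{N,M}$.
   Context: For $x\in\mathbb{N}$, $[x]=\{1,\ldots,x\}$, and $G_{N,M}=[N]\times[M]$ (the first coordinate indexes the $N$ rows within each of the $M$ columns). A rectangle of $G_{N,M}$ is a subset of the form $\{(a,b),(a+c_1,b),(a+c_1,b+c_2),(a,b+c_2)\}\subseteq G_{N,M}$ with $a,b,c_1,c_2$ positive integers. A partial or total mapping from $G_{N,M}$ to $[c]$ is a (partial or total) $c$-coloring if there is no rectangle all four of whose corners are colored and receive the same color. -}

module Defs where

open import Data.Nat using (ℕ)
open import Data.Fin using (Fin; _<_)
open import Data.Maybe using (Maybe; just; nothing)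
open import Data.Product using (_×_; ∃-syntax)
open import Relation.Binary.PropositionalEquality using (_≡_)
open import Relation.Nullary using (¬_)

-- The grid G_{N,M} = [N] × [M], 0-indexed: a point is (row i : Fin N, column j : Fin M).

PartialMap : ℕ → ℕ → ℕ → Set
PartialMap N M c = Fin N → Fin M → Maybe (Fin c)

TotalMap : ℕ → ℕ → ℕ → Set
TotalMap N M c = Fin N → Fin M → Fin c

MonoRectangle : {N M c : ℕ} → PartialMap N M c → Set
MonoRectangle {N} {M} {c} χ =
  ∃[ i ] ∃[ i' ] ∃[ j ] ∃[ j' ] ∃[ k ]
    (i < i') × (j < j') ×
    (χ i j ≡ just k) × (χ i' j ≡ just k) ×
    (χ i' j' ≡ just k) × (χ i j' ≡ just k)

IsPartialColoring : {N M c : ℕ} → PartialMap N M c → Set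
IsPartialColoring χ = ¬ MonoRectangle χ

total→partial : {N M c : ℕ} → TotalMap N M c → PartialMap N M c
total→partial χ i j = just (χ i j)

IsTotalColoring : {N M c : ℕ} → TotalMap N M c → Set
IsTotalColoring χ = IsPartialColoring (total→partial χ)

Extends : {N M c : ℕ} → TotalMap N M c → PartialMap N M c → Set
Extends {N} {M} {c} χ' χ = (i : Fin N) (j : Fin M) (k : Fin c) → χ i j ≡ just k → χ' i j ≡ k

module Submission where

-- The columns can be completed independently: a rectangle is spread
-- over two columns, and inside each of them it shows one colour twice.  So it
-- suffices to complete every column so that a colour occurring twice in the
-- completed column was already assigned there by χ.  Such a completion colours
-- each uncoloured cell with a colour that is new to its column and distinct
-- from the other new colours; this needs at most N ≤ c colours per column.
-- A monochromatic rectangle of the completion then has all four corners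
-- precoloured, i.e. it is a monochromatic rectangle of χ.

open import Defs
open import Data.Nat using (ℕ; zero; suc; _≤_; _<_; _+_; s≤s; NonZero)
open import Data.Nat.Properties using (≤-trans; ≤-reflexive; +-suc; +-monoʳ-<; module ≤-Reasoning)
open import Data.Fin using (Fin; zero; suc)
open import Data.Fin.Properties using (pigeonhole; <⇒≢; ¬∀⟶∃¬; _≟_)
open import Data.Maybe using (Maybe; just; nothing)
open import Data.Maybe.Properties using (just-injective)
open import Data.Maybe.Relation.Unary.Any using () renaming (Any to AnyMaybe; just to just⁺)
open import Data.List using (List; []; _∷_; length; _++_; lookup; allFin; mapMaybe)
open import Data.List.Properties using (length-++; length-mapMaybe; length-tabulate)
open import Data.List.Membership.Propositional using (_∈_; _∉_)
open import Data.List.Membership.Propositional.Properties using (∈-++⁺ˡ; ∈-++⁺ʳ; ∈-allFin)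
import Data.List.Membership.DecPropositional as DecMembership
open import Data.List.Relation.Unary.Any using (here; there; index)
open import Data.List.Relation.Unary.Any.Properties using (lookup-index; map⁺; mapMaybe⁺)
import Data.List.Relation.Unary.Any as Any
open import Data.Product using (∃-syntax; _×_; _,_; proj₁; proj₂)
open import Data.Empty using (⊥-elim)
open import Relation.Nullary using (¬_)
open import Function using (_∘_)
open import Relation.Binary.PropositionalEquality
  using (_≡_; _≢_; refl; sym; trans; cong; subst)

-- (1) A list of fewer than c colours misses some colour: otherwise sending each
-- colour to a position where it occurs would inject Fin c into a smaller Fin.
missing-colour : ∀ {c} (L : List (Fin c)) → length L < c → ∃[ k ] (k ∉ L)
missing-colour {c} L short = ¬∀⟶∃¬ c (_∈ L) (_∈? L) covers-all⇒⊥
  where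
  open DecMembership (_≟_ {c}) using (_∈?_)
  covers-all⇒⊥ : ¬ (∀ k → k ∈ L)
  covers-all⇒⊥ covers with pigeonhole short (index ∘ covers)
  ... | k , k' , k<k' , same-position =
    <⇒≢ k<k' k≡k'
    where
    -- k and k' are both the entry of L at the common position.
    k≡k' : k ≡ k'
    k≡k' = trans (lookup-index (covers k))
                   (trans (cong (lookup L) same-position) (sym (lookup-index (covers k'))))

Column : ℕ → ℕ → Set
Column N c = Fin N → Maybe (Fin c)

preset : ∀ {N c} → Column N c → List (Fin c)
preset {N} f = mapMaybe f (allFin N)

preset-length : ∀ {N c} (f : Column N c) → length (preset f) ≤ N
preset-length {N} f =
  ≤-trans (length-mapMaybe f (allFin N)) (≤-reflexive (length-tabulate (λ i → i)))

preset-∈ : ∀ {N c} (f : Column N c) {i k} → f i ≡ just k → k ∈ preset f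
preset-∈ {N} f {i} {k} fi≡k =
  mapMaybe⁺ f (allFin N) (map⁺ (Any.map reads-k (∈-allFin i)))
  where
  reads-k : ∀ {r} → i ≡ r → AnyMaybe (k ≡_) (f r)
  reads-k refl rewrite fi≡k = just⁺ refl

record Completion {N c} (A : List (Fin c)) (f : Column N c) : Set where
  field
    colour   : Fin N → Fin c
    keeps    : ∀ i {k} → f i ≡ just k → colour i ≡ k
    avoids   : ∀ i → f i ≡ nothing → colour i ∉ A
    new-only : ∀ i i' → f i ≡ nothing → colour i ≡ colour i' → i ≡ i'
open Completion

extend : ∀ {N c} {A : List (Fin c)} (f : Column (suc N) c) (h : Fin c) →
         (∀ {k} → f zero ≡ just k → h ≡ k) →
         (f zero ≡ nothing → h ∉ A) →
         (f zero ≡ nothing → h ∉ preset (f ∘ suc)) →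
         Completion (h ∷ A) (f ∘ suc) → Completion A f
extend {A = A} f h keeps-top avoids-A avoids-rest rest = record
  { colour = col ; keeps = col-keeps ; avoids = col-avoids ; new-only = col-new-only }
  where
  col : Fin _ → Fin _
  col zero    = h
  col (suc i) = colour rest i
  col-keeps : ∀ i {k} → f i ≡ just k → col i ≡ k
  col-keeps zero    = keeps-top
  col-keeps (suc i) = keeps rest i
  col-avoids : ∀ i → f i ≡ nothing → col i ∉ A
  col-avoids zero    = avoids-A
  col-avoids (suc i) new = avoids rest i new ∘ there
  -- A row of the rest sharing the top colour h is preset (h is not in the
  -- preset list) or new (new cells of the rest avoid h).
  top-unshared : ∀ i → f zero ≡ nothing → h ≢ colour rest i
  top-unshared i new h≡ with f (suc i) in fi
  ... | just k  = avoids-rest new (preset-∈ (f ∘ suc) (subst (λ x → f (suc i) ≡ just x) h-is-k fi))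
    where
    h-is-k : k ≡ h
    h-is-k = sym (trans h≡ (keeps rest i fi))
  ... | nothing = avoids rest i fi (here (sym h≡))
  col-new-only : ∀ i i' → f i ≡ nothing → col i ≡ col i' → i ≡ i'
  col-new-only zero    zero     new same = refl
  col-new-only zero    (suc i') new same = ⊥-elim (top-unshared i' new same)
  col-new-only (suc i) zero     new same = ⊥-elim (avoids rest i new (here same))
  col-new-only (suc i) (suc i') new same = cong suc (new-only rest i i' new same)

preset≢new : ∀ {c} {m : Maybe (Fin c)} {k} → m ≡ just k → m ≢ nothing
preset≢new refl ()

room-after : ∀ {c N} (A : List (Fin c)) h → length A + suc N ≤ c → length (h ∷ A) + N ≤ c
room-after {c} {N} A h = subst (_≤ c) (+-suc (length A) N)

complete : ∀ {c} N (A : List (Fin c)) → length A + N ≤ c → (f : Column N c) → Completion A f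
complete zero    A room f = record
  { colour = λ () ; keeps = λ () ; avoids = λ () ; new-only = λ () }
complete {c} (suc N) A room f with f zero in top
... | just k  = extend f k (just-injective ∘ trans (sym top))
                  (⊥-elim ∘ preset≢new top) (⊥-elim ∘ preset≢new top)
                  (complete N (k ∷ A) (room-after A k room) (f ∘ suc))
... | nothing = extend f h (λ e → ⊥-elim (preset≢new e top)) (λ _ → h∉ ∘ ∈-++⁺ˡ) (λ _ → h∉ ∘ ∈-++⁺ʳ A)
                  (complete N (h ∷ A) (room-after A h room) (f ∘ suc))
  where
  used-short : length (A ++ preset (f ∘ suc)) < c
  used-short = begin-strict
    length (A ++ preset (f ∘ suc))       ≡⟨ length-++ A ⟩
    length A + length (preset (f ∘ suc)) <⟨ +-monoʳ-< (length A) (s≤s (preset-length (f ∘ suc))) ⟩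
    length A + suc N                     ≤⟨ room ⟩
    c                                    ∎
    where open ≤-Reasoning
  h : Fin c
  h = proj₁ (missing-colour _ used-short)
  h∉ : h ∉ A ++ preset (f ∘ suc)
  h∉ = proj₂ (missing-colour _ used-short)

shared⇒preset : ∀ {N c} {A : List (Fin c)} {f : Column N c} (g : Completion A f) →
                ∀ {i i' k} → i ≢ i' → colour g i ≡ k → colour g i' ≡ k → f i ≡ just k
shared⇒preset {f = f} g {i} {i'} i≢i' gi gi' with f i in fi
... | just k₀ = cong just (trans (sym (keeps g i fi)) gi)
... | nothing = ⊥-elim (i≢i' (new-only g i i' fi (trans gi (sym gi'))))

-- (5) Completing every column gives a total colouring extending χ; the corners
-- of a monochromatic rectangle are all preset, contradicting that χ is one.
lemma4p4 : (c N M : ℕ) → .{{_ : NonZero c}} → .{{_ : NonZero N}} → .{{_ : NonZero M}} →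
    N ≤ c → (χ : PartialMap N M c) → IsPartialColoring χ →
    ∃[ χ' ] (IsTotalColoring χ' × Extends χ' χ)
lemma4p4 c N M N≤c χ χ-colouring = χ' , χ'-colouring , χ'-extends
  where
  column : (j : Fin M) → Completion [] (λ i → χ i j)
  column j = complete N [] N≤c (λ i → χ i j)
  χ' : TotalMap N M c
  χ' i j = colour (column j) i
  χ'-extends : Extends χ' χ
  χ'-extends i j k = keeps (column j) i
  χ'-colouring : IsTotalColoring χ'
  χ'-colouring (i , i' , j , j' , k , i<i' , j<j' , c₁ , c₂ , c₃ , c₄) =
    χ-colouring (i , i' , j , j' , k , i<i' , j<j' ,
      preset-at j  i≢i'       c₁ c₂ , preset-at j  (i≢i' ∘ sym) c₂ c₁ ,
      preset-at j' (i≢i' ∘ sym) c₃ c₄ , preset-at j' i≢i'       c₄ c₃)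
    where
    i≢i' = <⇒≢ i<i'
    -- Two corners in column j share the colour k, so both are preset.
    preset-at : ∀ j {i i'} → i ≢ i' → just (χ' i j) ≡ just k → just (χ' i' j) ≡ just k → χ i j ≡ just k
    preset-at j i≢i' e e' = shared⇒preset (column j) i≢i' (just-injective e) (just-injective e')
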